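{- For each $n$ there exists a prefix normal binary word $\tilde w$ of length $n$ such that the number of binary words of length $n$ whose prefix normal form is $\tilde w$ is $2^{n-O(\sqrt{n\log n})}$.
   Context: For a binary word $w=w_1\dots w_n\in\{0,1\}^n$ and $1\le j\le k\le n$, let $w[j,k]=w_j\dots w_k$ and let $|u|_1$ be the number of 1s in a binary word $u$. The profile of $w$ is $f_w(k)=\max_{0\le j\le n-k}|w[j+1,j+k]|_1$ for $0\le k\le n$. The word $w$ is prefix normal if $|w[1,k]|_1\ge|w[j+1,j+k]|_1$ for all $0\le k\le n$ and $0\le j\le n-k$. The prefix normal form of $w$ is the unique binary word $\tilde w$ of length $n$ with $|\tilde w[1,k]|_1=f_w(k)$ for all $0\le k\le n$ (well defined since $f_w(k)\le f_w(k+1)\le f_w(k)+1$); it is prefix normal. -}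

module Defs where

open import Data.Bool using (Bool; true; false)
open import Data.Nat using (ℕ; zero; suc; _+_; _∸_; _≤_; _⊔_; _≟_)
open import Data.List using (List; []; _∷_; _++_; map; take; drop; length; upTo; foldr; filter)
open import Data.List.Relation.Unary.All using (All; all?)
open import Data.Product using (_×_)
open import Relation.Binary.PropositionalEquality using (_≡_)
open import Relation.Nullary using (Dec)
open import Relation.Nullary.Decidable using (_×-dec_)

-- Binary words are lists of booleans (true = 1, false = 0).
Word : Set
Word = List Bool

ones : Word → ℕ
ones [] = 0
ones (true ∷ u) = suc (ones u)
ones (false ∷ u) = ones u

-- w[j+1, j+k]
window : Word → ℕ → ℕ → Word
window w j k = take k (drop j w)

profile : Word → ℕ → ℕ
profile w k = foldr _⊔_ 0 (map (λ j → ones (window w j k)) (upTo (suc (length w ∸ k))))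

PrefixNormal : Word → Set
PrefixNormal w = ∀ k j → k ≤ length w → j ≤ length w ∸ k →
  ones (window w j k) ≤ ones (take k w)

IsPNF : Word → Word → Set
IsPNF w v = length v ≡ length w ×
  All (λ k → ones (take k v) ≡ profile w k) (upTo (suc (length w)))

isPNF? : ∀ w v → Dec (IsPNF w v)
isPNF? w v = (length v ≟ length w) ×-dec all? (λ k → ones (take k v) ≟ profile w k) (upTo (suc (length w)))

allWords : ℕ → List Word
allWords zero = [] ∷ []
allWords (suc n) = map (false ∷_) (allWords n) ++ map (true ∷_) (allWords n)

pnfClassSize : ℕ → Word → ℕ
pnfClassSize n v = length (filter (λ w → isPNF? w v) (allWords n))

-- Read a word as a walk whose height after t letters is its excess, the number of
-- ones minus the number of zeros among them. If the walk of w stays within [0, R],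
-- every window of length k ≥ R contains at most ⌊(k + R)/2⌋ ones; if moreover it
-- climbs back to R regularly, these bounds are attained and w has the prefix normal
-- form 1^R (01)^h. This holds for every w = (10)^a 1^R b₁ ⋯ b_q whose blocks bᵢ are
-- Dyck words of a fixed length ℓ ≤ R. An arbitrary word x of length 2c is made into
-- such a block, injectively: flip a prefix of x to balance it (Knuth), rotate the
-- result at the maximum of its walk (cycle lemma), and append the two positions
-- used, in binary with digits coded by the Dyck words 0011 and 0101. With 2^e of
-- order √(n log n) and c ≈ 2^(e-1), only O(√(n log n)) of the n letters of w are
-- not free, so the class of 1^R (01)^h has 2^(n - O(√(n log n))) elements.

module Submission where

open import Defs
open import Data.Bool using (true; false; not)
open import Data.Empty using (⊥)
open import Data.List using (List; []; _∷_; _++_; map; take; drop; length; upTo; foldr; filter; replicate; concat)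
open import Data.List.Extrema.Nat using (argmax; argmax-all; f[xs]≤f[argmax])
open import Data.List.Membership.Propositional using (_∈_)
open import Data.List.Membership.Propositional.Properties
  using (∈-upTo⁺; ∈-upTo⁻; ∈-map⁺; ∈-map⁻; ∈-++⁺ˡ; ∈-++⁺ʳ; ∈-++⁻; ∈-filter⁺)
open import Data.List.Properties
  using ( length-++; length-map; length-replicate; length-take; length-drop; take-all; take-[]; take-take
        ; take++drop≡id; ++-assoc; ++-identityʳ; ++-cancelˡ; ∷-injective; ∷-injectiveˡ; ∷-injectiveʳ
        ; foldr-preservesᵇ; foldr-preservesᵒ)
open import Data.List.Relation.Unary.All as All using (All; []; _∷_)
open import Data.List.Relation.Unary.All.Properties using () renaming (map⁺ to All-map⁺)
open import Data.List.Relation.Unary.Any as Any using (here; there)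
open import Data.List.Relation.Unary.Unique.Propositional using (Unique; []; _∷_)
import Data.List.Relation.Unary.Unique.Propositional.Properties as Unique
open import Data.Nat
open import Data.Nat.DivMod using (_/_; _%_; m≡m%n+[m/n]*n; m%n<n)
open import Data.Nat.Induction using (<-rec)
open import Data.Nat.Logarithm using (⌈log₂_⌉; ⌈log₂⌉-mono-≤)
open import Data.Nat.Logarithm.Core using (⌈log2⌉-acc-irrelevant)
open import Data.Nat.Properties
open import Data.Nat.Tactic.RingSolver using (solve-∀)
open import Data.Parity.Base using (Parity; 0ℙ; 1ℙ)
open import Data.Product using (Σ; ∃; _×_; _,_; proj₁; proj₂)
open import Data.Sum using (_⊎_; inj₁; inj₂; [_,_]′)
open import Relation.Binary.PropositionalEquality
open import Relation.Nullary using (Dec; yes; no; contradiction)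
open import Algebra.Properties.CommutativeSemigroup +-commutativeSemigroup
  using (xy∙z≈xz∙y; x∙yz≈xz∙y; x∙yz≈yx∙z; xy∙z≈y∙zx)

-- Prefix counts and profiles

prefixOnes : Word → ℕ → ℕ
prefixOnes w t = ones (take t w)

ones-++ : ∀ u v → ones (u ++ v) ≡ ones u + ones v
ones-++ [] v = refl
ones-++ (true ∷ u) v = cong suc (ones-++ u v)
ones-++ (false ∷ u) v = ones-++ u v

prefixOnes≤ : ∀ (u : Word) k → prefixOnes u k ≤ k
prefixOnes≤ u zero = z≤n
prefixOnes≤ [] (suc k) = z≤n
prefixOnes≤ (true ∷ u) (suc k) = s≤s (prefixOnes≤ u k)
prefixOnes≤ (false ∷ u) (suc k) = m≤n⇒m≤1+n (prefixOnes≤ u k)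

take-+ : ∀ {A : Set} j k (w : List A) → take (j + k) w ≡ take j w ++ take k (drop j w)
take-+ zero k w = refl
take-+ (suc j) k [] = sym (take-[] k)
take-+ (suc j) k (x ∷ w) = cong (x ∷_) (take-+ j k w)

prefixOnes-+ : ∀ w j k → prefixOnes w (j + k) ≡ prefixOnes w j + ones (window w j k)
prefixOnes-+ w j k = trans (cong ones (take-+ j k w)) (ones-++ (take j w) (take k (drop j w)))

take-++ˡ : ∀ {A : Set} (u v : List A) {t} → t ≤ length u → take t (u ++ v) ≡ take t u
take-++ˡ u v {zero} _ = refl
take-++ˡ (x ∷ u) v {suc t} (s≤s t≤u) = cong (x ∷_) (take-++ˡ u v t≤u)

take-++ʳ : ∀ {A : Set} (u v : List A) t → take (length u + t) (u ++ v) ≡ u ++ take t v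
take-++ʳ [] v t = refl
take-++ʳ (x ∷ u) v t = cong (x ∷_) (take-++ʳ u v t)

++-injective : ∀ {A : Set} (u u′ v v′ : List A) → length u ≡ length u′ → u ++ v ≡ u′ ++ v′ → u ≡ u′ × v ≡ v′
++-injective [] [] v v′ _ eq = refl , eq
++-injective (x ∷ u) (x′ ∷ u′) v v′ |u|≡ eq with ∷-injective eq
... | refl , tail with ++-injective u u′ v v′ (suc-injective |u|≡) tail
...   | refl , v≡ = refl , v≡

prefixOnes-++ˡ : ∀ u v {t} → t ≤ length u → prefixOnes (u ++ v) t ≡ prefixOnes u t
prefixOnes-++ˡ u v t≤u = cong ones (take-++ˡ u v t≤u)

prefixOnes-++ʳ : ∀ u v t → prefixOnes (u ++ v) (length u + t) ≡ ones u + prefixOnes v t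
prefixOnes-++ʳ u v t = trans (cong ones (take-++ʳ u v t)) (ones-++ u (take t v))

prefixOnes-length : ∀ u → prefixOnes u (length u) ≡ ones u
prefixOnes-length u = cong ones (take-all (length u) u ≤-refl)

split-++ : ∀ {A : Set} (u : List A) t → t ≤ length u ⊎ ∃ λ t′ → t ≡ length u + t′
split-++ u t with t ≤? length u
... | yes t≤u = inj₁ t≤u
... | no t≰u = inj₂ (t ∸ length u , sym (m+[n∸m]≡n (<⇒≤ (≰⇒> t≰u))))

profile-≡ : ∀ w k G → (∀ j → j ≤ length w ∸ k → ones (window w j k) ≤ G) →
  (∃ λ j → j ≤ length w ∸ k × ones (window w j k) ≡ G) → profile w k ≡ G
profile-≡ w k G bounded (j , j≤ , attained) = ≤-antisym
  (foldr-preservesᵇ {P = _≤ G} ⊔-lub z≤n (All-map⁺ (All.tabulate λ j∈ → bounded _ (≤-pred (∈-upTo⁻ j∈)))))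
  (foldr-preservesᵒ {P = G ≤_} (λ x y → [ m≤n⇒m≤n⊔o y , m≤n⇒m≤o⊔n x ]′) 0 _
    (inj₂ (Any.map (λ { refl → ≤-reflexive (sym attained) }) (∈-map⁺ _ (∈-upTo⁺ (s≤s j≤))))))

isPNF-self : ∀ v → PrefixNormal v → IsPNF v v
isPNF-self v pn = refl , All.tabulate λ {k} k∈ → sym (profile-≡ v k (prefixOnes v k)
  (λ j j≤ → pn k j (≤-pred (∈-upTo⁻ k∈)) j≤) (0 , z≤n , refl))

-- A criterion for the prefix normal form

-- 2 · prefixOnes w t − t is the excess of the first t letters of w.
Band : ℕ → Word → Set
Band R w = ∀ t → t ≤ length w → t ≤ 2 * prefixOnes w t × 2 * prefixOnes w t ≤ t + R

Saturated : ℕ → Word → Set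
Saturated R v = (∀ k → k ≤ R → k ≤ length v → prefixOnes v k ≡ k) ×
                (∀ k → R ≤ k → k ≤ length v → k + R ≤ suc (2 * prefixOnes v k))

Attains : Word → Word → Set
Attains w v = ∀ k → k ≤ length w → ∃ λ j → j + k ≤ length w × prefixOnes v k ≤ ones (window w j k)

2*m≤1+2*n⇒m≤n : ∀ {m n} → 2 * m ≤ suc (2 * n) → m ≤ n
2*m≤1+2*n⇒m≤n {m} {n} le = ≤-pred (*-cancelˡ-< 2 m (suc n) (s≤s (≤-trans le (≤-reflexive (sym (cong pred (*-suc 2 n)))))))

band-window : ∀ R w j k → Band R w → j + k ≤ length w → 2 * ones (window w j k) ≤ k + R
band-window R w j k band j+k≤ = +-cancelˡ-≤ j _ _ (begin
  j + 2 * o                          ≤⟨ +-monoˡ-≤ (2 * o) (proj₁ (band j (≤-trans (m≤m+n j k) j+k≤))) ⟩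
  2 * prefixOnes w j + 2 * o         ≡⟨ *-distribˡ-+ 2 (prefixOnes w j) o ⟨
  2 * (prefixOnes w j + o)           ≡⟨ cong (2 *_) (prefixOnes-+ w j k) ⟨
  2 * prefixOnes w (j + k)           ≤⟨ proj₂ (band (j + k) j+k≤) ⟩
  j + k + R                          ≡⟨ +-assoc j k R ⟩
  j + (k + R)                        ∎)
  where
  open ≤-Reasoning
  o = ones (window w j k)

window≤prefixOnes : ∀ R w v j k → Band R w → Saturated R v → j + k ≤ length w → k ≤ length v →
  ones (window w j k) ≤ prefixOnes v k
window≤prefixOnes R w v j k band (full , high) j+k≤ k≤v with k ≤? R
... | yes k≤R = subst (ones (window w j k) ≤_) (sym (full k k≤R k≤v)) (prefixOnes≤ (drop j w) k)
... | no k≰R = 2*m≤1+2*n⇒m≤n (≤-trans (band-window R w j k band j+k≤) (high k (<⇒≤ (≰⇒> k≰R)) k≤v))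

band⇒prefixNormal : ∀ R v → Band R v → Saturated R v → PrefixNormal v
band⇒prefixNormal R v band sat k j k≤ j≤ =
  window≤prefixOnes R v v j k band sat (m≤o∸n⇒m+n≤o j k≤ j≤) k≤

band⇒isPNF : ∀ R w v → length v ≡ length w → Band R w → Saturated R v → Attains w v → IsPNF w v
band⇒isPNF R w v |v|≡|w| band sat attains =
  |v|≡|w| , All.tabulate λ {k} k∈ → sym (profile≡ k (≤-pred (∈-upTo⁻ k∈)))
  where
  profile≡ : ∀ k → k ≤ length w → profile w k ≡ prefixOnes v k
  profile≡ k k≤ with attains k k≤
  ... | j , j+k≤ , v≤ = profile-≡ w k (prefixOnes v k)
    (λ j′ j′≤ → below j′ (m≤o∸n⇒m+n≤o j′ k≤ j′≤))
    (j , m+n≤o⇒m≤o∸n j j+k≤ , ≤-antisym (below j j+k≤) v≤)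
    where
    below : ∀ j → j + k ≤ length w → ones (window w j k) ≤ prefixOnes v k
    below j j+k≤ = window≤prefixOnes R w v j k band sat j+k≤ (subst (k ≤_) (sym |v|≡|w|) k≤)

-- The target word and the family of words sharing it

alt₁₀ : ℕ → Word
alt₁₀ zero = []
alt₁₀ (suc a) = true ∷ false ∷ alt₁₀ a

alt₀₁ : ℕ → Word
alt₀₁ zero = []
alt₀₁ (suc h) = false ∷ true ∷ alt₀₁ h

length-alt₁₀ : ∀ a → length (alt₁₀ a) ≡ 2 * a
length-alt₁₀ zero = refl
length-alt₁₀ (suc a) = trans (cong (2 +_) (length-alt₁₀ a)) (sym (*-suc 2 a))

length-alt₀₁ : ∀ h → length (alt₀₁ h) ≡ 2 * h
length-alt₀₁ zero = refl
length-alt₀₁ (suc h) = trans (cong (2 +_) (length-alt₀₁ h)) (sym (*-suc 2 h))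

ones-alt₁₀ : ∀ a → ones (alt₁₀ a) ≡ a
ones-alt₁₀ zero = refl
ones-alt₁₀ (suc a) = cong suc (ones-alt₁₀ a)

ones-replicate : ∀ R → ones (replicate R true) ≡ R
ones-replicate zero = refl
ones-replicate (suc R) = cong suc (ones-replicate R)

prefixOnes-replicate : ∀ R {t} → t ≤ R → prefixOnes (replicate R true) t ≡ t
prefixOnes-replicate R z≤n = refl
prefixOnes-replicate (suc R) (s≤s t≤R) = cong suc (prefixOnes-replicate R t≤R)

alt₁₀-excess : ∀ a t → t ≤ length (alt₁₀ a) →
  t ≤ 2 * prefixOnes (alt₁₀ a) t × 2 * prefixOnes (alt₁₀ a) t ≤ suc t
alt₁₀-excess a zero _ = z≤n , z≤n
alt₁₀-excess (suc a) (suc zero) _ = s≤s z≤n , s≤s (s≤s z≤n)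
alt₁₀-excess (suc a) (suc (suc t)) (s≤s (s≤s t≤)) rewrite *-suc 2 (prefixOnes (alt₁₀ a) t) =
  let lo , hi = alt₁₀-excess a t t≤ in s≤s (s≤s lo) , s≤s (s≤s hi)

alt₀₁-deficit : ∀ h t → t ≤ length (alt₀₁ h) →
  2 * prefixOnes (alt₀₁ h) t ≤ t × t ≤ suc (2 * prefixOnes (alt₀₁ h) t)
alt₀₁-deficit h zero _ = z≤n , z≤n
alt₀₁-deficit (suc h) (suc zero) _ = z≤n , s≤s z≤n
alt₀₁-deficit (suc h) (suc (suc t)) (s≤s (s≤s t≤)) rewrite *-suc 2 (prefixOnes (alt₀₁ h) t) =
  let lo , hi = alt₀₁-deficit h t t≤ in s≤s (s≤s lo) , s≤s (s≤s hi)

length-offset : ∀ {A : Set} (u v : List A) {t′} → length u + t′ ≤ length (u ++ v) → t′ ≤ length v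
length-offset u v le = +-cancelˡ-≤ (length u) _ _ (≤-trans le (≤-reflexive (length-++ u)))

AtTop : ℕ → Word → Set
AtTop R u = 2 * ones u ≡ length u + R

lead : ℕ → ℕ → Word
lead a R = alt₁₀ a ++ replicate R true

target : ℕ → ℕ → Word
target R h = replicate R true ++ alt₀₁ h

length-lead : ∀ a R → length (lead a R) ≡ 2 * a + R
length-lead a R = trans (length-++ (alt₁₀ a)) (cong₂ _+_ (length-alt₁₀ a) (length-replicate R))

length-target : ∀ R h → length (target R h) ≡ R + 2 * h
length-target R h = trans (length-++ (replicate R true)) (cong₂ _+_ (length-replicate R) (length-alt₀₁ h))

lead-atTop : ∀ a R → AtTop R (lead a R)
lead-atTop a R = begin
  2 * ones (lead a R)          ≡⟨ cong (2 *_) (trans (ones-++ (alt₁₀ a) _) (cong₂ _+_ (ones-alt₁₀ a) (ones-replicate R))) ⟩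
  2 * (a + R)                  ≡⟨ double-+ a R ⟩
  2 * a + R + R                ≡⟨ cong (_+ R) (length-lead a R) ⟨
  length (lead a R) + R        ∎
  where
  open ≡-Reasoning
  double-+ : ∀ a R → 2 * (a + R) ≡ 2 * a + R + R
  double-+ = solve-∀

lead-band : ∀ a R → 1 ≤ R → Band R (lead a R)
lead-band a R 1≤R t t≤ with split-++ (alt₁₀ a) t
... | inj₁ t≤alt rewrite prefixOnes-++ˡ (alt₁₀ a) (replicate R true) t≤alt =
  let lo , hi = alt₁₀-excess a t t≤alt
  in lo , ≤-trans hi (subst (_≤ t + R) (+-comm t 1) (+-monoʳ-≤ t 1≤R))
... | inj₂ (t′ , refl)
  rewrite prefixOnes-++ʳ (alt₁₀ a) (replicate R true) t′ | ones-alt₁₀ a =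
  let t′≤R = subst (t′ ≤_) (length-replicate R) (length-offset (alt₁₀ a) _ t≤)
  in subst (λ p → length (alt₁₀ a) + t′ ≤ 2 * (a + p) × 2 * (a + p) ≤ length (alt₁₀ a) + t′ + R)
       (sym (prefixOnes-replicate R t′≤R)) (ramp {a = a} (length-alt₁₀ a) t′≤R)
  where
  ramp : ∀ {L a t R} → L ≡ 2 * a → t ≤ R → L + t ≤ 2 * (a + t) × 2 * (a + t) ≤ L + t + R
  ramp {L} {a} {t} {R} refl t≤R = subst (2 * a + t ≤_) (sym (double a t)) (m≤m+n (2 * a + t) t) ,
                                  subst (_≤ 2 * a + t + R) (sym (double a t)) (+-monoʳ-≤ (2 * a + t) t≤R)
    where
    double : ∀ a t → 2 * (a + t) ≡ 2 * a + t + t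
    double = solve-∀

target-band : ∀ R h → 1 ≤ R → Band R (target R h)
target-band R h 1≤R t t≤ with split-++ (replicate R true) t
... | inj₁ t≤R rewrite prefixOnes-++ˡ (replicate R true) (alt₀₁ h) t≤R
                     | prefixOnes-replicate R (subst (t ≤_) (length-replicate R) t≤R) =
  m≤m+n t (t + 0) , +-monoʳ-≤ t (subst (_≤ R) (sym (+-identityʳ t)) (subst (t ≤_) (length-replicate R) t≤R))
... | inj₂ (t′ , refl) rewrite prefixOnes-++ʳ (replicate R true) (alt₀₁ h) t′ | ones-replicate R =
  descent (length-replicate R) 1≤R (alt₀₁-deficit h t′ (length-offset (replicate R true) _ t≤))
  where
  descent : ∀ {L R t p} → L ≡ R → 1 ≤ R → 2 * p ≤ t × t ≤ suc (2 * p) →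
    L + t ≤ 2 * (R + p) × 2 * (R + p) ≤ L + t + R
  descent {R = R} {t} {p} refl 1≤R (lo , hi) = subst (λ x → R + t ≤ x × x ≤ R + t + R) (sym (double R p))
    ( ≤-trans (+-monoʳ-≤ R hi) (subst (_≤ R + R + 2 * p) (sym (+-suc R (2 * p))) (+-monoˡ-≤ (2 * p) (+-monoˡ-≤ R 1≤R)))
    , subst (R + R + 2 * p ≤_) (xy∙z≈xz∙y R R t) (+-monoʳ-≤ (R + R) lo))
    where
    double : ∀ R p → 2 * (R + p) ≡ R + R + 2 * p
    double = solve-∀

target-saturated : ∀ R h → Saturated R (target R h)
target-saturated R h = full , high
  where
  full : ∀ k → k ≤ R → k ≤ length (target R h) → prefixOnes (target R h) k ≡ k
  full k k≤R _ = trans (prefixOnes-++ˡ (replicate R true) (alt₀₁ h) (subst (k ≤_) (sym (length-replicate R)) k≤R))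
                       (prefixOnes-replicate R k≤R)
  high : ∀ k → R ≤ k → k ≤ length (target R h) → k + R ≤ suc (2 * prefixOnes (target R h) k)
  high k R≤k k≤ with split-++ (replicate R true) k
  ... | inj₁ k≤rep = let k≤R = subst (k ≤_) (length-replicate R) k≤rep in
    subst (λ p → k + R ≤ suc (2 * p)) (sym (full k k≤R k≤))
      (≤-trans (+-monoʳ-≤ k R≤k) (≤-trans (≤-reflexive (cong (k +_) (sym (+-identityʳ k)))) (n≤1+n _)))
  ... | inj₂ (t′ , refl) rewrite prefixOnes-++ʳ (replicate R true) (alt₀₁ h) t′ | ones-replicate R =
    climb (length-replicate R) (proj₂ (alt₀₁-deficit h t′ (length-offset (replicate R true) _ k≤)))
    where
    climb : ∀ {L R t p} → L ≡ R → t ≤ suc (2 * p) → L + t + R ≤ suc (2 * (R + p))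
    climb {R = R} {t} {p} refl t≤ = subst₂ _≤_ (xy∙z≈xz∙y R R t) (double R p) (+-monoʳ-≤ (R + R) t≤)
      where
      double : ∀ R p → R + R + suc (2 * p) ≡ suc (2 * (R + p))
      double = solve-∀

-- Dyck paths stay weakly below zero here: no prefix has more ones than zeros.
Dyck : Word → Set
Dyck b = (∀ t → 2 * prefixOnes b t ≤ t) × 2 * ones b ≡ length b

dyck-++ : ∀ u v → Dyck u → Dyck v → Dyck (u ++ v)
dyck-++ u v (u≤ , u-bal) (v≤ , v-bal) = ≤ , bal
  where
  bal : 2 * ones (u ++ v) ≡ length (u ++ v)
  bal = trans (cong (2 *_) (ones-++ u v))
       (trans (*-distribˡ-+ 2 (ones u) (ones v)) (trans (cong₂ _+_ u-bal v-bal) (sym (length-++ u))))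
  ≤ : ∀ t → 2 * prefixOnes (u ++ v) t ≤ t
  ≤ t with split-++ u t
  ... | inj₁ t≤u rewrite prefixOnes-++ˡ u v t≤u = u≤ t
  ... | inj₂ (t′ , refl) rewrite prefixOnes-++ʳ u v t′ | *-distribˡ-+ 2 (ones u) (prefixOnes v t′) | u-bal =
    +-monoʳ-≤ (length u) (v≤ t′)

band-++-dyck : ∀ R u b → Band R u → AtTop R u → Dyck b → length b ≤ R →
  Band R (u ++ b) × AtTop R (u ++ b)
band-++-dyck R u b band top (b≤ , b-bal) |b|≤R = band′ , top′
  where
  top′ : AtTop R (u ++ b)
  top′ = begin
    2 * ones (u ++ b)            ≡⟨ cong (2 *_) (ones-++ u b) ⟩
    2 * (ones u + ones b)        ≡⟨ *-distribˡ-+ 2 (ones u) (ones b) ⟩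
    2 * ones u + 2 * ones b      ≡⟨ cong₂ _+_ top b-bal ⟩
    length u + R + length b      ≡⟨ xy∙z≈xz∙y (length u) R (length b) ⟩
    length u + length b + R      ≡⟨ cong (_+ R) (length-++ u) ⟨
    length (u ++ b) + R          ∎
    where open ≡-Reasoning
  band′ : Band R (u ++ b)
  band′ t t≤ with split-++ u t
  ... | inj₁ t≤u rewrite prefixOnes-++ˡ u b t≤u = band t t≤u
  ... | inj₂ (t′ , refl) rewrite prefixOnes-++ʳ u b t′ | *-distribˡ-+ 2 (ones u) (prefixOnes b t′) | top =
    ≤-trans (+-monoʳ-≤ (length u) (≤-trans (≤-trans (length-offset u b t≤) |b|≤R) (m≤m+n R _)))
            (≤-reflexive (sym (+-assoc (length u) R _))) ,
    ≤-trans (≤-reflexive (+-assoc (length u) R _))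
            (≤-trans (+-monoʳ-≤ (length u) (+-monoʳ-≤ R (b≤ t′))) (≤-reflexive (x∙yz≈xz∙y (length u) R t′)))

Blocks : ℕ → List Word → Set
Blocks ℓ = All (λ b → Dyck b × length b ≡ ℓ)

length-concat-blocks : ∀ ℓ bs → Blocks ℓ bs → length (concat bs) ≡ length bs * ℓ
length-concat-blocks ℓ [] [] = refl
length-concat-blocks ℓ (b ∷ bs) ((_ , |b|≡ℓ) ∷ blocks) =
  trans (length-++ b) (cong₂ _+_ |b|≡ℓ (length-concat-blocks ℓ bs blocks))

band-++-blocks : ∀ R ℓ u bs → ℓ ≤ R → Band R u → AtTop R u → Blocks ℓ bs →
  Band R (u ++ concat bs) × AtTop R (u ++ concat bs)
band-++-blocks R ℓ u [] ℓ≤R band top [] rewrite ++-identityʳ u = band , top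
band-++-blocks R ℓ u (b ∷ bs) ℓ≤R band top ((dyck , |b|≡ℓ) ∷ blocks) rewrite sym (++-assoc u b (concat bs)) =
  let band′ , top′ = band-++-dyck R u b band top dyck (subst (_≤ R) (sym |b|≡ℓ) ℓ≤R)
  in band-++-blocks R ℓ (u ++ b) bs ℓ≤R band′ top′ blocks

atTop-blocks : ∀ R ℓ u bs → ℓ ≤ R → Band R u → AtTop R u → Blocks ℓ bs → ∀ i → i ≤ length bs →
  2 * prefixOnes (u ++ concat bs) (length u + i * ℓ) ≡ length u + i * ℓ + R
atTop-blocks R ℓ u bs ℓ≤R band top blocks zero _ =
  trans (cong (2 *_) (trans (prefixOnes-++ʳ u (concat bs) 0) (+-identityʳ (ones u))))
        (trans top (cong (_+ R) (sym (+-identityʳ _))))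
atTop-blocks R ℓ u (b ∷ bs) ℓ≤R band top ((dyck , |b|≡ℓ) ∷ blocks) (suc i) (s≤s i≤)
  rewrite sym (++-assoc u b (concat bs)) =
  let band′ , top′ = band-++-dyck R u b band top dyck (subst (_≤ R) (sym |b|≡ℓ) ℓ≤R)
  in subst (λ z → 2 * prefixOnes ((u ++ b) ++ concat bs) z ≡ z + R) shift
       (atTop-blocks R ℓ (u ++ b) bs ℓ≤R band′ top′ blocks i i≤)
  where
  shift : length (u ++ b) + i * ℓ ≡ length u + suc i * ℓ
  shift = trans (cong (_+ i * ℓ) (trans (length-++ u) (cong (length u +_) |b|≡ℓ))) (+-assoc (length u) ℓ (i * ℓ))

top-near : ∀ q base ℓ c k → ℓ ≤ c → base ≤ k + c → k ≤ base + q * ℓ →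
  ∃ λ i → i ≤ q × k ≤ base + i * ℓ × base + i * ℓ ≤ k + c
top-near q base ℓ c k ℓ≤c base≤ k≤ with k ≤? base
... | yes k≤base = 0 , z≤n , subst (k ≤_) (sym (+-identityʳ base)) k≤base , subst (_≤ k + c) (sym (+-identityʳ base)) base≤
top-near zero base ℓ c k ℓ≤c base≤ k≤ | no k≰base = contradiction (subst (k ≤_) (+-identityʳ base) k≤) k≰base
top-near (suc q) base ℓ c k ℓ≤c base≤ k≤ | no k≰base
  with top-near q (base + ℓ) ℓ c k ℓ≤c (+-mono-≤ (<⇒≤ (≰⇒> k≰base)) ℓ≤c) (subst (k ≤_) (sym (+-assoc base ℓ (q * ℓ))) k≤)
... | i , i≤q , k≤t , t≤ = suc i , s≤s i≤q , subst (k ≤_) shift k≤t , subst (_≤ k + c) shift t≤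
  where
  shift : base + ℓ + i * ℓ ≡ base + suc i * ℓ
  shift = +-assoc base ℓ (i * ℓ)

window-below-top : ∀ R w j k → 2 * prefixOnes w (j + k) ≡ j + k + R → 2 * prefixOnes w j ≤ suc j →
  k + R ≤ suc (2 * ones (window w j k))
window-below-top R w j k top low = +-cancelˡ-≤ j _ _ (begin
  j + (k + R)                          ≡⟨ +-assoc j k R ⟨
  j + k + R                            ≡⟨ top ⟨
  2 * prefixOnes w (j + k)             ≡⟨ cong (2 *_) (prefixOnes-+ w j k) ⟩
  2 * (prefixOnes w j + o)             ≡⟨ *-distribˡ-+ 2 (prefixOnes w j) o ⟩
  2 * prefixOnes w j + 2 * o           ≤⟨ +-monoˡ-≤ (2 * o) low ⟩
  suc j + 2 * o                        ≡⟨ +-suc j (2 * o) ⟨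
  j + suc (2 * o)                      ∎)
  where
  open ≤-Reasoning
  o = ones (window w j k)

module Construction (a R ℓ : ℕ) (bs : List Word) (1≤R : 1 ≤ R) (ℓ≤R : ℓ ≤ R) (ℓ≤2a : ℓ ≤ 2 * a)
                    (blocks : Blocks ℓ bs) where

  w : Word
  w = lead a R ++ concat bs

  length-w : length w ≡ 2 * a + R + length bs * ℓ
  length-w = trans (length-++ (lead a R)) (cong₂ _+_ (length-lead a R) (length-concat-blocks ℓ bs blocks))

  w-band×atTop : Band R w × AtTop R w
  w-band×atTop = band-++-blocks R ℓ (lead a R) bs ℓ≤R (lead-band a R 1≤R) (lead-atTop a R) blocks

  w-assoc : w ≡ alt₁₀ a ++ (replicate R true ++ concat bs)
  w-assoc = ++-assoc (alt₁₀ a) (replicate R true) (concat bs)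

  w-low : ∀ t → t ≤ 2 * a → 2 * prefixOnes w t ≤ suc t
  w-low t t≤ rewrite w-assoc | prefixOnes-++ˡ (alt₁₀ a) (replicate R true ++ concat bs) (subst (t ≤_) (sym (length-alt₁₀ a)) t≤) =
    proj₂ (alt₁₀-excess a t (subst (t ≤_) (sym (length-alt₁₀ a)) t≤))

  w-plateau : ∀ t → t ≤ R → prefixOnes w (2 * a + t) ≡ a + t
  w-plateau t t≤R = begin
    prefixOnes w (2 * a + t)                          ≡⟨ cong₂ prefixOnes w-assoc (cong (_+ t) (sym (length-alt₁₀ a))) ⟩
    prefixOnes (alt₁₀ a ++ rest) (length (alt₁₀ a) + t) ≡⟨ prefixOnes-++ʳ (alt₁₀ a) rest t ⟩
    ones (alt₁₀ a) + prefixOnes rest t                ≡⟨ cong₂ _+_ (ones-alt₁₀ a) (prefixOnes-++ˡ (replicate R true) (concat bs)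
                                                           (subst (t ≤_) (sym (length-replicate R)) t≤R)) ⟩
    a + prefixOnes (replicate R true) t               ≡⟨ cong (a +_) (prefixOnes-replicate R t≤R) ⟩
    a + t                                             ∎
    where
    open ≡-Reasoning
    rest = replicate R true ++ concat bs

  w-top : ∀ i → i ≤ length bs → 2 * prefixOnes w (2 * a + R + i * ℓ) ≡ 2 * a + R + i * ℓ + R
  w-top i i≤ = subst (λ L → 2 * prefixOnes w (L + i * ℓ) ≡ L + i * ℓ + R) (length-lead a R)
    (atTop-blocks R ℓ (lead a R) bs ℓ≤R (lead-band a R 1≤R) (lead-atTop a R) blocks i i≤)

  -- Short windows are found in the plateau 1^R. A long window is chosen to end where the
  -- walk of w is at R and to start inside (10)^a, where the walk is at most 1.
  w-attains : ∀ h → length (target R h) ≡ length w → Attains w (target R h)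
  w-attains h |v|≡|w| k k≤ with k ≤? R
  ... | yes k≤R = 2 * a , ≤-trans (+-monoʳ-≤ (2 * a) k≤R) (≤-trans (m≤m+n (2 * a + R) _) (≤-reflexive (sym length-w))) ,
                  subst (prefixOnes (target R h) k ≤_) (sym all-ones) (prefixOnes≤ (target R h) k)
    where
    all-ones : ones (window w (2 * a) k) ≡ k
    all-ones = +-cancelˡ-≡ a _ _ (begin
      a + ones (window w (2 * a) k)                    ≡⟨ cong (_+ ones (window w (2 * a) k)) start ⟨
      prefixOnes w (2 * a) + ones (window w (2 * a) k) ≡⟨ prefixOnes-+ w (2 * a) k ⟨
      prefixOnes w (2 * a + k)                         ≡⟨ w-plateau k k≤R ⟩
      a + k                                            ∎)
      where
      open ≡-Reasoning
      start : prefixOnes w (2 * a) ≡ a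
      start = trans (cong (prefixOnes w) (sym (+-identityʳ (2 * a)))) (trans (w-plateau 0 z≤n) (+-identityʳ a))
  ... | no k≰R with top-near (length bs) (2 * a + R) ℓ (2 * a) k ℓ≤2a
                    (subst (2 * a + R ≤_) (+-comm (2 * a) k) (+-monoʳ-≤ (2 * a) (<⇒≤ (≰⇒> k≰R))))
                    (subst (k ≤_) length-w k≤)
  ... | i , i≤ , k≤t , t≤ = j , j+k≤ ,
        2*m≤1+2*n⇒m≤n (≤-trans (proj₂ (target-band R h 1≤R k (subst (k ≤_) (sym |v|≡|w|) k≤)))
                                (window-below-top R w j k (subst (λ x → 2 * prefixOnes w x ≡ x + R) (sym j+k≡t) (w-top i i≤))
                                                          (w-low j j≤2a)))
    where
    t = 2 * a + R + i * ℓ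
    j = t ∸ k
    j+k≡t : j + k ≡ t
    j+k≡t = m∸n+n≡m k≤t
    j+k≤ : j + k ≤ length w
    j+k≤ = subst₂ _≤_ (sym j+k≡t) (sym length-w) (+-monoʳ-≤ (2 * a + R) (*-monoˡ-≤ ℓ i≤))
    j≤2a : j ≤ 2 * a
    j≤2a = m≤n+o⇒m∸n≤o t k t≤

  w-isPNF : ∀ h → length (target R h) ≡ length w → IsPNF w (target R h)
  w-isPNF h |v|≡|w| = band⇒isPNF R w (target R h) |v|≡|w| (proj₁ w-band×atTop) (target-saturated R h) (w-attains h |v|≡|w|)

lead-blocks-isPNF : ∀ a R ℓ bs h → 1 ≤ R → ℓ ≤ R → ℓ ≤ 2 * a → Blocks ℓ bs →
  R + 2 * h ≡ 2 * a + R + length bs * ℓ → IsPNF (lead a R ++ concat bs) (target R h)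
lead-blocks-isPNF a R ℓ bs h 1≤R ℓ≤R ℓ≤2a blocks lengths =
  w-isPNF h (trans (length-target R h) (trans lengths (sym length-w)))
  where open Construction a R ℓ bs 1≤R ℓ≤R ℓ≤2a blocks

target-prefixNormal : ∀ R h → 1 ≤ R → PrefixNormal (target R h)
target-prefixNormal R h 1≤R = band⇒prefixNormal R (target R h) (target-band R h 1≤R) (target-saturated R h)

-- Turning an arbitrary word into a Dyck block

flipPrefix : ℕ → Word → Word
flipPrefix i x = map not (take i x) ++ drop i x

length-flipPrefix : ∀ i x → length (flipPrefix i x) ≡ length x
length-flipPrefix zero x = refl
length-flipPrefix (suc i) [] = refl
length-flipPrefix (suc i) (y ∷ x) = cong suc (length-flipPrefix i x)

flipPrefix-involutive : ∀ i x → flipPrefix i (flipPrefix i x) ≡ x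
flipPrefix-involutive zero x = refl
flipPrefix-involutive (suc i) [] = refl
flipPrefix-involutive (suc i) (true ∷ x) = cong (true ∷_) (flipPrefix-involutive i x)
flipPrefix-involutive (suc i) (false ∷ x) = cong (false ∷_) (flipPrefix-involutive i x)

ones-flipPrefix : ∀ i x → i ≤ length x → ones (flipPrefix i x) + 2 * prefixOnes x i ≡ i + ones x
ones-flipPrefix zero x _ = +-identityʳ (ones x)
ones-flipPrefix (suc i) (false ∷ x) (s≤s i≤) = cong suc (ones-flipPrefix i x i≤)
ones-flipPrefix (suc i) (true ∷ x) (s≤s i≤) = begin
  o + 2 * suc p         ≡⟨ cong (o +_) (*-suc 2 p) ⟩
  o + (2 + 2 * p)       ≡⟨ +-suc o (suc (2 * p)) ⟩
  suc (o + suc (2 * p)) ≡⟨ cong suc (+-suc o (2 * p)) ⟩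
  2 + (o + 2 * p)       ≡⟨ cong (2 +_) (ones-flipPrefix i x i≤) ⟩
  2 + (i + ones x)      ≡⟨ cong suc (+-suc i (ones x)) ⟨
  suc i + suc (ones x)  ∎
  where
  open ≡-Reasoning
  o = ones (flipPrefix i x)
  p = prefixOnes x i

prefixOnes-step : ∀ x i → prefixOnes x (suc i) ≡ prefixOnes x i ⊎ prefixOnes x (suc i) ≡ suc (prefixOnes x i)
prefixOnes-step [] i = inj₁ (refl′ i)
  where
  refl′ : ∀ i → prefixOnes [] (suc i) ≡ prefixOnes [] i
  refl′ zero = refl
  refl′ (suc i) = refl
prefixOnes-step (true ∷ x) zero = inj₂ refl
prefixOnes-step (false ∷ x) zero = inj₁ refl
prefixOnes-step (true ∷ x) (suc i) with prefixOnes-step x i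
... | inj₁ same = inj₁ (cong suc same)
... | inj₂ up = inj₂ (cong suc up)
prefixOnes-step (false ∷ x) (suc i) = prefixOnes-step x i

UnitSteps : (ℕ → ℕ) → ℕ → Set
UnitSteps g m = ∀ i → i < m → g (suc i) ≡ suc (g i) ⊎ suc (g (suc i)) ≡ g i

unitSteps-pred : ∀ {g m} → UnitSteps g (suc m) → UnitSteps g m
unitSteps-pred steps i i<m = steps i (m<n⇒m<1+n i<m)

ivt-up : ∀ g c m → UnitSteps g m → g 0 ≤ c → c ≤ g m → ∃ λ i → i ≤ m × g i ≡ c
ivt-up g c zero steps lo hi = 0 , z≤n , ≤-antisym lo hi
ivt-up g c (suc m) steps lo hi with c ≤? g m
... | yes c≤ = let i , i≤m , gi≡c = ivt-up g c m (unitSteps-pred steps) lo c≤ in i , m≤n⇒m≤1+n i≤m , gi≡c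
... | no c≰ with steps m ≤-refl
...   | inj₁ up = suc m , ≤-refl , ≤-antisym (subst (_≤ c) (sym up) (≰⇒> c≰)) hi
...   | inj₂ down = contradiction (≤-trans hi (≤-trans (n≤1+n _) (≤-reflexive down))) c≰

ivt-down : ∀ g c m → UnitSteps g m → c ≤ g 0 → g m ≤ c → ∃ λ i → i ≤ m × g i ≡ c
ivt-down g c zero steps hi lo = 0 , z≤n , ≤-antisym lo hi
ivt-down g c (suc m) steps hi lo with g m ≤? c
... | yes ≤c = let i , i≤m , gi≡c = ivt-down g c m (unitSteps-pred steps) hi ≤c in i , m≤n⇒m≤1+n i≤m , gi≡c
... | no ≰c with steps m ≤-refl
...   | inj₁ up = contradiction (≤-trans (n≤1+n _) (≤-trans (≤-reflexive (sym up)) lo)) ≰c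
...   | inj₂ down = suc m , ≤-refl , ≤-antisym lo (≤-pred (subst (c <_) (sym down) (≰⇒> ≰c)))

ones-flipPrefix-suc : ∀ x i → suc i ≤ length x →
  ones (flipPrefix (suc i) x) + 2 * prefixOnes x (suc i) ≡ suc (ones (flipPrefix i x) + 2 * prefixOnes x i)
ones-flipPrefix-suc x i i< = trans (ones-flipPrefix (suc i) x i<) (cong suc (sym (ones-flipPrefix i x (<⇒≤ i<))))

flipOnes-steps : ∀ x → UnitSteps (λ i → ones (flipPrefix i x)) (length x)
flipOnes-steps x i i< with prefixOnes x (suc i) | prefixOnes-step x i | ones-flipPrefix-suc x i i<
... | _ | inj₁ refl | step = inj₁ (+-cancelʳ-≡ _ _ _ step)
... | _ | inj₂ refl | step = inj₂ (suc-injective (+-cancelʳ-≡ _ _ _ (trans (sym (shift _ (prefixOnes x i))) step)))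
  where
  shift : ∀ g p → g + 2 * suc p ≡ suc (suc g) + 2 * p
  shift = solve-∀

ones-flipAll : ∀ x → ones (flipPrefix (length x) x) + ones x ≡ length x
ones-flipAll x = +-cancelʳ-≡ (ones x) _ _ (begin
  g + ones x + ones x           ≡⟨ +-assoc g (ones x) (ones x) ⟩
  g + (ones x + ones x)         ≡⟨ cong (λ p → g + (ones x + p)) (+-identityʳ (ones x)) ⟨
  g + 2 * ones x                ≡⟨ cong (λ p → g + 2 * p) (prefixOnes-length x) ⟨
  g + 2 * prefixOnes x (length x) ≡⟨ ones-flipPrefix (length x) x ≤-refl ⟩
  length x + ones x             ∎)
  where
  open ≡-Reasoning
  g = ones (flipPrefix (length x) x)

-- Knuth's balancing argument: flipping prefixes of growing length changes the number
-- of ones by ±1 at each step and ends at the complementary count.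
balancing : ∀ x → ∃ λ i → i ≤ length x × ones (flipPrefix i x) ≡ ⌊ length x /2⌋
balancing x = crossing (ones x ≤? h)
  where
  open ≤-Reasoning
  L = length x
  h = ⌊ L /2⌋
  g = λ i → ones (flipPrefix i x)
  crossing : Dec (ones x ≤ h) → ∃ λ i → i ≤ L × g i ≡ h
  crossing (yes o≤h) = ivt-up g h L (flipOnes-steps x) o≤h (+-cancelʳ-≤ (ones x) h (g L) (begin
    h + ones x                    ≤⟨ +-monoʳ-≤ h (≤-trans o≤h (⌊n/2⌋≤⌈n/2⌉ L)) ⟩
    h + ⌈ L /2⌉                   ≡⟨ ⌊n/2⌋+⌈n/2⌉≡n L ⟩
    L                             ≡⟨ ones-flipAll x ⟨
    g L + ones x                  ∎))
  crossing (no o≰h) = ivt-down g h L (flipOnes-steps x) (<⇒≤ (≰⇒> o≰h)) (+-cancelʳ-≤ (ones x) (g L) h (begin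
    g L + ones x                  ≡⟨ ones-flipAll x ⟩
    L                             ≡⟨ ⌊n/2⌋+⌈n/2⌉≡n L ⟨
    h + ⌈ L /2⌉                   ≤⟨ +-monoʳ-≤ h (≤-trans (⌊n/2⌋-mono (n≤1+n (suc L))) (≰⇒> o≰h)) ⟩
    h + ones x                    ∎))

-- Opaque so that type checking never unfolds the search inside balancing.
opaque
  balancingIndex : Word → ℕ
  balancingIndex x = proj₁ (balancing x)

  balancingIndex≤ : ∀ x → balancingIndex x ≤ length x
  balancingIndex≤ x = proj₁ (proj₂ (balancing x))

  ones-balancingFlip : ∀ x → ones (flipPrefix (balancingIndex x) x) ≡ ⌊ length x /2⌋
  ones-balancingFlip x = proj₂ (proj₂ (balancing x))

balance : Word → Word
balance x = flipPrefix (balancingIndex x) x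

balance-balanced : ∀ x c → length x ≡ 2 * c → 2 * ones (balance x) ≡ length (balance x)
balance-balanced x c |x|≡ = begin
  2 * ones (balance x)          ≡⟨ cong (2 *_) (ones-balancingFlip x) ⟩
  2 * ⌊ length x /2⌋            ≡⟨ cong (λ L → 2 * ⌊ L /2⌋) (trans |x|≡ (cong (c +_) (+-identityʳ c))) ⟩
  2 * ⌊ c + c /2⌋               ≡⟨ cong (2 *_) (n≡⌊n+n/2⌋ c) ⟨
  2 * c                         ≡⟨ |x|≡ ⟨
  length x                      ≡⟨ length-flipPrefix (balancingIndex x) x ⟨
  length (balance x)            ∎
  where open ≡-Reasoning

rotate : ℕ → Word → Word
rotate s b = drop s b ++ take s b

-- The excess 2 · prefixOnes b t − t, shifted by length b to stay in ℕ.
shiftedExcess : Word → ℕ → ℕ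
shiftedExcess b t = 2 * prefixOnes b t + (length b ∸ t)

-- Opaque so that type checking never unfolds argmax.
opaque
  peak : Word → ℕ
  peak b = argmax (shiftedExcess b) 0 (upTo (suc (length b)))

  peak≤ : ∀ b → peak b ≤ length b
  peak≤ b = argmax-all (shiftedExcess b) {P = _≤ length b} z≤n (All.tabulate λ t∈ → ≤-pred (∈-upTo⁻ t∈))

  shiftedExcess≤peak : ∀ b t → t ≤ length b → shiftedExcess b t ≤ shiftedExcess b (peak b)
  shiftedExcess≤peak b t t≤ = All.lookup (f[xs]≤f[argmax] {f = shiftedExcess b} 0 (upTo (suc (length b)))) (∈-upTo⁺ (s≤s t≤))

peak-max : ∀ b t → t ≤ length b → 2 * prefixOnes b t + peak b ≤ 2 * prefixOnes b (peak b) + t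
peak-max b t t≤ = +-cancelʳ-≤ (length b) _ _ (begin
  2 * prefixOnes b t + s + L                   ≡⟨ cong (λ z → 2 * prefixOnes b t + s + z) (m∸n+n≡m t≤) ⟨
  2 * prefixOnes b t + s + (L ∸ t + t)         ≡⟨ regroup (2 * prefixOnes b t) s (L ∸ t) t ⟩
  2 * prefixOnes b t + (L ∸ t) + (s + t)       ≤⟨ +-monoˡ-≤ (s + t) (shiftedExcess≤peak b t t≤) ⟩
  2 * prefixOnes b s + (L ∸ s) + (s + t)       ≡⟨ regroup′ (2 * prefixOnes b s) t (L ∸ s) s ⟨
  2 * prefixOnes b s + t + (L ∸ s + s)         ≡⟨ cong (λ z → 2 * prefixOnes b s + t + z) (m∸n+n≡m (peak≤ b)) ⟩
  2 * prefixOnes b s + t + L                   ∎)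
  where
  open ≤-Reasoning
  L = length b
  s = peak b
  regroup : ∀ p s d t → p + s + (d + t) ≡ p + d + (s + t)
  regroup = solve-∀
  regroup′ : ∀ p t d s → p + t + (d + s) ≡ p + d + (s + t)
  regroup′ = solve-∀

ones-take+drop : ∀ s (b : Word) → prefixOnes b s + ones (drop s b) ≡ ones b
ones-take+drop s b = trans (sym (ones-++ (take s b) (drop s b))) (cong ones (take++drop≡id s b))

length-rotate : ∀ s b → s ≤ length b → length (rotate s b) ≡ length b
length-rotate s b s≤ = begin
  length (drop s b ++ take s b)         ≡⟨ length-++ (drop s b) ⟩
  length (drop s b) + length (take s b) ≡⟨ cong₂ _+_ (length-drop s b) (trans (length-take s b) (m≤n⇒m⊓n≡m s≤)) ⟩
  (length b ∸ s) + s                    ≡⟨ m∸n+n≡m s≤ ⟩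
  length b                              ∎
  where open ≡-Reasoning

rotate-injective : ∀ s b b′ → length b ≡ length b′ → rotate s b ≡ rotate s b′ → b ≡ b′
rotate-injective s b b′ |b|≡ eq
  with ++-injective (drop s b) (drop s b′) _ _ (trans (length-drop s b) (trans (cong (_∸ s) |b|≡) (sym (length-drop s b′)))) eq
... | drops , takes = begin
  b                        ≡⟨ take++drop≡id s b ⟨
  take s b ++ drop s b     ≡⟨ cong₂ _++_ takes drops ⟩
  take s b′ ++ drop s b′   ≡⟨ take++drop≡id s b′ ⟩
  b′                       ∎
  where open ≡-Reasoning

rotate-dyck : ∀ b s → 2 * ones b ≡ length b → s ≤ length b →
  (∀ t → t ≤ length b → 2 * prefixOnes b t + s ≤ 2 * prefixOnes b s + t) → Dyck (rotate s b)
rotate-dyck b s balanced s≤ maximal = below , balanced′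
  where
  D = drop s b
  T = take s b
  |T|≡s : length T ≡ s
  |T|≡s = trans (length-take s b) (m≤n⇒m⊓n≡m s≤)
  s+|D|≡ : s + length D ≡ length b
  s+|D|≡ = trans (cong (s +_) (length-drop s b)) (m+[n∸m]≡n s≤)
  ones-rotate : ones (rotate s b) ≡ ones b
  ones-rotate = trans (ones-++ D T) (trans (+-comm (ones D) (ones T)) (ones-take+drop s b))
  balanced′ : 2 * ones (rotate s b) ≡ length (rotate s b)
  balanced′ = trans (cong (2 *_) ones-rotate) (trans balanced (sym (length-rotate s b s≤)))
  split-ones : 2 * prefixOnes b s + 2 * ones D ≡ s + length D
  split-ones = trans (sym (*-distribˡ-+ 2 (prefixOnes b s) (ones D)))
                     (trans (cong (2 *_) (ones-take+drop s b)) (trans balanced (sym s+|D|≡)))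
  open ≤-Reasoning
  inside : ∀ t → t ≤ length D → 2 * prefixOnes D t ≤ t
  inside t t≤ = +-cancelˡ-≤ (2 * prefixOnes b s) _ _ (+-cancelʳ-≤ s _ _ (begin
    2 * prefixOnes b s + 2 * prefixOnes D t + s ≡⟨ cong (_+ s) (*-distribˡ-+ 2 (prefixOnes b s) (prefixOnes D t)) ⟨
    2 * (prefixOnes b s + prefixOnes D t) + s   ≡⟨ cong (λ p → 2 * p + s) (prefixOnes-+ b s t) ⟨
    2 * prefixOnes b (s + t) + s                ≤⟨ maximal (s + t) (≤-trans (+-monoʳ-≤ s t≤) (≤-reflexive s+|D|≡)) ⟩
    2 * prefixOnes b s + (s + t)                ≡⟨ x∙yz≈xz∙y (2 * prefixOnes b s) s t ⟩
    2 * prefixOnes b s + t + s                  ∎))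
  wrapped : ∀ t → t ≤ s → 2 * (ones D + prefixOnes b t) ≤ length D + t
  wrapped t t≤s = +-cancelʳ-≤ s _ _ (begin
    2 * (ones D + prefixOnes b t) + s           ≡⟨ distrib (ones D) (prefixOnes b t) s ⟩
    2 * ones D + (2 * prefixOnes b t + s)       ≤⟨ +-monoʳ-≤ (2 * ones D) (maximal t (≤-trans t≤s s≤)) ⟩
    2 * ones D + (2 * prefixOnes b s + t)       ≡⟨ x∙yz≈yx∙z (2 * ones D) (2 * prefixOnes b s) t ⟩
    2 * prefixOnes b s + 2 * ones D + t         ≡⟨ cong (_+ t) split-ones ⟩
    s + length D + t                            ≡⟨ xy∙z≈y∙zx s (length D) t ⟩
    length D + (t + s)                          ≡⟨ +-assoc (length D) t s ⟨
    length D + t + s                            ∎)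
    where
    distrib : ∀ d p s → 2 * (d + p) + s ≡ 2 * d + (2 * p + s)
    distrib = solve-∀
  beyond : ∀ t → s ≤ t → 2 * (ones D + prefixOnes b s) ≤ length D + t
  beyond t s≤t = begin
    2 * (ones D + prefixOnes b s)               ≡⟨ cong (2 *_) (+-comm (ones D) (prefixOnes b s)) ⟩
    2 * (prefixOnes b s + ones D)               ≡⟨ *-distribˡ-+ 2 (prefixOnes b s) (ones D) ⟩
    2 * prefixOnes b s + 2 * ones D             ≡⟨ split-ones ⟩
    s + length D                                ≤⟨ +-monoˡ-≤ (length D) s≤t ⟩
    t + length D                                ≡⟨ +-comm t (length D) ⟩
    length D + t                                ∎
  below : ∀ t → 2 * prefixOnes (rotate s b) t ≤ t
  below t with split-++ D t
  ... | inj₁ t≤ rewrite prefixOnes-++ˡ D T t≤ = inside t t≤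
  ... | inj₂ (t′ , refl) rewrite prefixOnes-++ʳ D T t′ with t′ ≤? s
  ...   | yes t′≤s rewrite take-take t′ s b | m≤n⇒m⊓n≡m t′≤s = wrapped t′ t′≤s
  ...   | no t′≰s rewrite take-all t′ T (≤-trans (≤-reflexive |T|≡s) (<⇒≤ (≰⇒> t′≰s))) =
    beyond t′ (<⇒≤ (≰⇒> t′≰s))

bitCode : Parity → Word
bitCode 0ℙ = false ∷ false ∷ true ∷ true ∷ []
bitCode 1ℙ = false ∷ true ∷ false ∷ true ∷ []

bitCode-dyck : ∀ p → Dyck (bitCode p)
bitCode-dyck 0ℙ = (λ { 0 → z≤n ; 1 → z≤n ; 2 → z≤n ; 3 → s≤s (s≤s z≤n)
                     ; 4 → s≤s (s≤s (s≤s (s≤s z≤n))) ; (suc (suc (suc (suc (suc t))))) → s≤s (s≤s (s≤s (s≤s z≤n))) }) , refl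
bitCode-dyck 1ℙ = (λ { 0 → z≤n ; 1 → z≤n ; 2 → s≤s (s≤s z≤n) ; 3 → s≤s (s≤s z≤n)
                     ; 4 → s≤s (s≤s (s≤s (s≤s z≤n))) ; (suc (suc (suc (suc (suc t))))) → s≤s (s≤s (s≤s (s≤s z≤n))) }) , refl

length-bitCode : ∀ p → length (bitCode p) ≡ 4
length-bitCode 0ℙ = refl
length-bitCode 1ℙ = refl

bitCode-injective : ∀ p q → bitCode p ≡ bitCode q → p ≡ q
bitCode-injective 0ℙ 0ℙ _ = refl
bitCode-injective 1ℙ 1ℙ _ = refl

encode : ℕ → ℕ → Word
encode zero n = []
encode (suc e) n = bitCode (parity n) ++ encode e ⌊ n /2⌋

length-encode : ∀ e n → length (encode e n) ≡ 4 * e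
length-encode zero n = refl
length-encode (suc e) n = trans (length-++ (bitCode (parity n)))
  (trans (cong₂ _+_ (length-bitCode (parity n)) (length-encode e ⌊ n /2⌋)) (sym (*-suc 4 e)))

encode-dyck : ∀ e n → Dyck (encode e n)
encode-dyck zero n = (λ t → subst (λ p → 2 * ones p ≤ t) (sym (take-[] t)) z≤n) , refl
encode-dyck (suc e) n = dyck-++ _ _ (bitCode-dyck (parity n)) (encode-dyck e ⌊ n /2⌋)

parity-⌊/2⌋-injective : ∀ m n → parity m ≡ parity n → ⌊ m /2⌋ ≡ ⌊ n /2⌋ → m ≡ n
parity-⌊/2⌋-injective 0 0 _ _ = refl
parity-⌊/2⌋-injective 1 1 _ _ = refl
parity-⌊/2⌋-injective (suc (suc m)) (suc (suc n)) same halves =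
  cong (2 +_) (parity-⌊/2⌋-injective m n same (suc-injective halves))
parity-⌊/2⌋-injective 0 1 () _
parity-⌊/2⌋-injective 1 0 () _
parity-⌊/2⌋-injective 0 (suc (suc n)) _ ()
parity-⌊/2⌋-injective 1 (suc (suc n)) _ ()
parity-⌊/2⌋-injective (suc (suc m)) 0 _ ()
parity-⌊/2⌋-injective (suc (suc m)) 1 _ ()

⌊n/2⌋<2^e : ∀ n e → n < 2 ^ suc e → ⌊ n /2⌋ < 2 ^ e
⌊n/2⌋<2^e n e n< = *-cancelˡ-< 2 ⌊ n /2⌋ (2 ^ e) (≤-<-trans double≤n n<)
  where
  double≤n : 2 * ⌊ n /2⌋ ≤ n
  double≤n = subst₂ _≤_ (cong (⌊ n /2⌋ +_) (sym (+-identityʳ _))) (⌊n/2⌋+⌈n/2⌉≡n n)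
                    (+-monoʳ-≤ ⌊ n /2⌋ (⌊n/2⌋≤⌈n/2⌉ n))

encode-injective : ∀ e m n → m < 2 ^ e → n < 2 ^ e → encode e m ≡ encode e n → m ≡ n
encode-injective zero 0 0 _ _ _ = refl
encode-injective zero (suc m) _ (s≤s ()) _ _
encode-injective zero _ (suc n) _ (s≤s ()) _
encode-injective (suc e) m n m< n< eq
  with ++-injective (bitCode (parity m)) (bitCode (parity n)) _ _
         (trans (length-bitCode (parity m)) (sym (length-bitCode (parity n)))) eq
... | bits , rest = parity-⌊/2⌋-injective m n (bitCode-injective _ _ bits)
  (encode-injective e ⌊ m /2⌋ ⌊ n /2⌋ (⌊n/2⌋<2^e m e m<) (⌊n/2⌋<2^e n e n<) rest)

-- The two codes record what is needed to undo the rotation and the flip.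
block : ℕ → Word → Word
block e x = rotate (peak (balance x)) (balance x) ++ (encode e (balancingIndex x) ++ encode e (peak (balance x)))

length-balance : ∀ x → length (balance x) ≡ length x
length-balance x = length-flipPrefix (balancingIndex x) x

length-block : ∀ e x → length (block e x) ≡ length x + (4 * e + 4 * e)
length-block e x = trans (length-++ (rotate s b))
  (cong₂ _+_ (trans (length-rotate s b (peak≤ b)) (length-balance x))
             (trans (length-++ (encode e (balancingIndex x))) (cong₂ _+_ (length-encode e _) (length-encode e s))))
  where
  b = balance x
  s = peak b

block-dyck : ∀ e x c → length x ≡ 2 * c → Dyck (block e x)
block-dyck e x c |x|≡ = dyck-++ _ _
  (rotate-dyck b (peak b) (balance-balanced x c |x|≡) (peak≤ b) (peak-max b))
  (dyck-++ _ _ (encode-dyck e _) (encode-dyck e _))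
  where b = balance x

block-injective : ∀ e x x′ → length x ≡ length x′ → length x < 2 ^ e → block e x ≡ block e x′ → x ≡ x′
block-injective e x x′ |x|≡ |x|< eq = begin
  x                         ≡⟨ flipPrefix-involutive i x ⟨
  flipPrefix i b            ≡⟨ cong (flipPrefix i) (rotate-injective s b b′ |b|≡ same-rotation) ⟩
  flipPrefix i b′           ≡⟨ cong (λ k → flipPrefix k b′) same-index ⟩
  flipPrefix i′ b′          ≡⟨ flipPrefix-involutive i′ x′ ⟩
  x′                        ∎
  where
  open ≡-Reasoning
  b = balance x
  b′ = balance x′
  i = balancingIndex x
  i′ = balancingIndex x′
  s = peak b
  s′ = peak b′
  |b|≡ : length b ≡ length b′
  |b|≡ = trans (length-balance x) (trans |x|≡ (sym (length-balance x′)))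
  small : ∀ y {k} → k ≤ length y → length y ≡ length x → k < 2 ^ e
  small y k≤ |y|≡ = ≤-<-trans k≤ (subst (_< 2 ^ e) (sym |y|≡) |x|<)
  rotation×codes : rotate s b ≡ rotate s′ b′ × encode e i ++ encode e s ≡ encode e i′ ++ encode e s′
  rotation×codes = ++-injective (rotate s b) (rotate s′ b′) _ _
    (trans (length-rotate s b (peak≤ b)) (trans |b|≡ (sym (length-rotate s′ b′ (peak≤ b′))))) eq
  codes : encode e i ≡ encode e i′ × encode e s ≡ encode e s′
  codes = ++-injective (encode e i) (encode e i′) _ _
    (trans (length-encode e i) (sym (length-encode e i′))) (proj₂ rotation×codes)
  same-index : i ≡ i′
  same-index = encode-injective e i i′ (small x (balancingIndex≤ x) refl)
                                       (small x′ (balancingIndex≤ x′) (sym |x|≡)) (proj₁ codes)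
  same-peak : s ≡ s′
  same-peak = encode-injective e s s′ (small x (subst (s ≤_) (length-balance x) (peak≤ b)) refl)
                                      (small x′ (subst (s′ ≤_) (length-balance x′) (peak≤ b′)) (sym |x|≡)) (proj₂ codes)
  same-rotation : rotate s b ≡ rotate s b′
  same-rotation = trans (proj₁ rotation×codes) (cong (λ k → rotate k b′) (sym same-peak))

-- Counting

remove : ∀ {A : Set} {x : A} {ys} → x ∈ ys → List A
remove {ys = _ ∷ ys} (here _) = ys
remove {ys = y ∷ ys} (there x∈) = y ∷ remove x∈

length-remove : ∀ {A : Set} {x : A} {ys} (x∈ : x ∈ ys) → length ys ≡ suc (length (remove x∈))
length-remove (here _) = refl
length-remove (there x∈) = cong suc (length-remove x∈)

∈-remove : ∀ {A : Set} {x y : A} {ys} (x∈ : x ∈ ys) → y ∈ ys → x ≢ y → y ∈ remove x∈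
∈-remove (here refl) (here refl) x≢y = contradiction refl x≢y
∈-remove (here refl) (there y∈) x≢y = y∈
∈-remove (there x∈) (here refl) x≢y = here refl
∈-remove (there x∈) (there y∈) x≢y = there (∈-remove x∈ y∈ x≢y)

unique-⊆⇒length≤ : ∀ {A : Set} {xs ys : List A} → Unique xs → All (_∈ ys) xs → length xs ≤ length ys
unique-⊆⇒length≤ [] [] = z≤n
unique-⊆⇒length≤ (x∉ ∷ unique) (x∈ ∷ xs⊆) = subst (_ ≤_) (sym (length-remove x∈))
  (s≤s (unique-⊆⇒length≤ unique (All.zipWith (λ (x≢y , y∈) → ∈-remove x∈ y∈ x≢y) (x∉ , xs⊆))))

map-unique : ∀ {A B : Set} {P : A → Set} (f : A → B) {xs} → (∀ {z z′} → P z → P z′ → f z ≡ f z′ → z ≡ z′) →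
  All P xs → Unique xs → Unique (map f xs)
map-unique f inj [] [] = []
map-unique f inj (pz ∷ ps) (z∉ ∷ unique) =
  All-map⁺ (All.zipWith (λ (z≢z′ , pz′) fz≡ → z≢z′ (inj pz pz′ fz≡)) (z∉ , ps)) ∷ map-unique f inj ps unique

length-allWords : ∀ N → length (allWords N) ≡ 2 ^ N
length-allWords zero = refl
length-allWords (suc N) = begin
  length (map (false ∷_) ws ++ map (true ∷_) ws)          ≡⟨ length-++ (map (false ∷_) ws) ⟩
  length (map (false ∷_) ws) + length (map (true ∷_) ws)  ≡⟨ cong₂ _+_ (length-map _ ws) (length-map _ ws) ⟩
  length ws + length ws                                   ≡⟨ cong₂ _+_ (length-allWords N) (trans (length-allWords N) (sym (+-identityʳ _))) ⟩
  2 ^ suc N                                               ∎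
  where
  open ≡-Reasoning
  ws = allWords N

∈-allWords : ∀ w → w ∈ allWords (length w)
∈-allWords [] = here refl
∈-allWords (false ∷ w) = ∈-++⁺ˡ (∈-map⁺ (false ∷_) (∈-allWords w))
∈-allWords (true ∷ w) = ∈-++⁺ʳ (map (false ∷_) (allWords (length w))) (∈-map⁺ (true ∷_) (∈-allWords w))

allWords-length : ∀ N {w} → w ∈ allWords N → length w ≡ N
allWords-length zero (here refl) = refl
allWords-length (suc N) w∈ with ∈-++⁻ (map (false ∷_) (allWords N)) w∈
... | inj₁ w∈₀ with ∈-map⁻ (false ∷_) w∈₀
...   | u , u∈ , refl = cong suc (allWords-length N u∈)
allWords-length (suc N) w∈ | inj₂ w∈₁ with ∈-map⁻ (true ∷_) w∈₁
...   | u , u∈ , refl = cong suc (allWords-length N u∈)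

allWords-unique : ∀ N → Unique (allWords N)
allWords-unique zero = [] ∷ []
allWords-unique (suc N) = Unique.++⁺ (Unique.map⁺ ∷-injectiveʳ (allWords-unique N))
                                     (Unique.map⁺ ∷-injectiveʳ (allWords-unique N)) disjoint
  where
  disjoint : ∀ {w} → w ∈ map (false ∷_) (allWords N) × w ∈ map (true ∷_) (allWords N) → ⊥
  disjoint (w∈₀ , w∈₁) with ∈-map⁻ (false ∷_) w∈₀ | ∈-map⁻ (true ∷_) w∈₁
  ... | _ , _ , refl | _ , _ , ()

injection⇒2^N≤pnfClassSize : ∀ (F : Word → Word) N n v →
  (∀ z → length z ≡ N → length (F z) ≡ n × IsPNF (F z) v) →
  (∀ {z z′} → length z ≡ N → length z′ ≡ N → F z ≡ F z′ → z ≡ z′) →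
  2 ^ N ≤ pnfClassSize n v
injection⇒2^N≤pnfClassSize F N n v into inj =
  subst (_≤ pnfClassSize n v) (trans (length-map F (allWords N)) (length-allWords N))
    (unique-⊆⇒length≤ (map-unique F inj lengths (allWords-unique N)) (All-map⁺ (All.map member lengths)))
  where
  lengths : All (λ z → length z ≡ N) (allWords N)
  lengths = All.tabulate (allWords-length N)
  member : ∀ {z} → length z ≡ N → F z ∈ filter (λ w → isPNF? w v) (allWords n)
  member {z} |z|≡ = let |Fz|≡ , pnf = into z |z|≡ in
    ∈-filter⁺ (λ w → isPNF? w v) (subst (λ k → F z ∈ allWords k) |Fz|≡ (∈-allWords (F z))) pnf

chunks : ℕ → ℕ → Word → List Word
chunks m zero z = []
chunks m (suc q) z = take m z ∷ chunks m q (drop m z)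

length-chunks : ∀ m q z → length (chunks m q z) ≡ q
length-chunks m zero z = refl
length-chunks m (suc q) z = cong suc (length-chunks m q (drop m z))

chunks-length : ∀ m q z → length z ≡ q * m → All (λ y → length y ≡ m) (chunks m q z)
chunks-length m zero z _ = []
chunks-length m (suc q) z |z|≡ =
  trans (length-take m z) (m≤n⇒m⊓n≡m (subst (m ≤_) (sym |z|≡) (m≤m+n m (q * m)))) ∷
  chunks-length m q (drop m z) (trans (length-drop m z) (trans (cong (_∸ m) |z|≡) (m+n∸m≡n m (q * m))))

chunks-injective : ∀ m q z z′ → length z ≡ q * m → length z′ ≡ q * m → chunks m q z ≡ chunks m q z′ → z ≡ z′
chunks-injective m zero [] [] _ _ _ = refl
chunks-injective m (suc q) z z′ |z|≡ |z′|≡ eq = begin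
  z                         ≡⟨ take++drop≡id m z ⟨
  take m z ++ drop m z      ≡⟨ cong₂ _++_ (∷-injectiveˡ eq) (chunks-injective m q (drop m z) (drop m z′) (rest z |z|≡) (rest z′ |z′|≡) (∷-injectiveʳ eq)) ⟩
  take m z′ ++ drop m z′    ≡⟨ take++drop≡id m z′ ⟩
  z′                        ∎
  where
  open ≡-Reasoning
  rest : ∀ y → length y ≡ suc q * m → length (drop m y) ≡ q * m
  rest y |y|≡ = trans (length-drop m y) (trans (cong (_∸ m) |y|≡) (m+n∸m≡n m (q * m)))

concatMap-injective : ∀ (g : Word → Word) m →
  (∀ {y y′} → length y ≡ m → length y′ ≡ m → length (g y) ≡ length (g y′)) →
  (∀ {y y′} → length y ≡ m → length y′ ≡ m → g y ≡ g y′ → y ≡ y′) →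
  ∀ {ys ys′} → All (λ y → length y ≡ m) ys → All (λ y → length y ≡ m) ys′ →
  length ys ≡ length ys′ → concat (map g ys) ≡ concat (map g ys′) → ys ≡ ys′
concatMap-injective g m same-length inj [] [] _ _ = refl
concatMap-injective g m same-length inj (|y| ∷ |ys|) (|y′| ∷ |ys′|) |ys|≡ eq
  with ++-injective _ _ _ _ (same-length |y| |y′|) eq
... | heads , tails = cong₂ _∷_ (inj |y| |y′| heads)
                               (concatMap-injective g m same-length inj |ys| |ys′| (suc-injective |ys|≡) tails)

blockLength : ℕ → ℕ → ℕ
blockLength e c = 2 * c + (4 * e + 4 * e)

length-target-family : ∀ a R q c e → R + 2 * (a + q * (c + 4 * e)) ≡ 2 * a + R + q * blockLength e c
length-target-family a R q c e = arrange a R q c e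
  where
  arrange : ∀ a R q c e → R + 2 * (a + q * (c + 4 * e)) ≡ 2 * a + R + q * (2 * c + (4 * e + 4 * e))
  arrange = solve-∀

blocks-of : ∀ e c q z → length z ≡ q * (2 * c) → Blocks (blockLength e c) (map (block e) (chunks (2 * c) q z))
blocks-of e c q z |z|≡ = All-map⁺ (All.map (λ {y} |y|≡ → block-dyck e y c |y|≡ , trans (length-block e y) (cong (_+ _) |y|≡))
                                            (chunks-length (2 * c) q z |z|≡))

blockFamily : ∀ e c a R q → 2 * c < 2 ^ e → 1 ≤ R → blockLength e c ≤ R → blockLength e c ≤ 2 * a →
  2 ^ (q * (2 * c)) ≤ pnfClassSize (2 * a + R + q * blockLength e c) (target R (a + q * (c + 4 * e)))
blockFamily e c a R q 2c<2^e 1≤R ℓ≤R ℓ≤2a = injection⇒2^N≤pnfClassSize F (q * (2 * c)) _ _ into inj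
  where
  ℓ = blockLength e c
  F : Word → Word
  F z = lead a R ++ concat (map (block e) (chunks (2 * c) q z))
  into : ∀ z → length z ≡ q * (2 * c) →
    length (F z) ≡ 2 * a + R + q * ℓ × IsPNF (F z) (target R (a + q * (c + 4 * e)))
  into z |z|≡ = trans |Fz| (cong (λ k → 2 * a + R + k * ℓ) |bs|) ,
                lead-blocks-isPNF a R ℓ bs _ 1≤R ℓ≤R ℓ≤2a blocks
                  (trans (length-target-family a R q c e) (cong (λ k → 2 * a + R + k * ℓ) (sym |bs|)))
    where
    bs = map (block e) (chunks (2 * c) q z)
    blocks : Blocks ℓ bs
    blocks = blocks-of e c q z |z|≡
    |bs| : length bs ≡ q
    |bs| = trans (length-map (block e) (chunks (2 * c) q z)) (length-chunks (2 * c) q z)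
    |Fz| : length (F z) ≡ 2 * a + R + length bs * ℓ
    |Fz| = trans (length-++ (lead a R)) (cong₂ _+_ (length-lead a R) (length-concat-blocks ℓ bs blocks))
  inj : ∀ {z z′} → length z ≡ q * (2 * c) → length z′ ≡ q * (2 * c) → F z ≡ F z′ → z ≡ z′
  inj {z} {z′} |z|≡ |z′|≡ eq = chunks-injective (2 * c) q z z′ |z|≡ |z′|≡
    (concatMap-injective (block e) (2 * c)
      (λ {y} {y′} |y|≡ |y′|≡ → trans (length-block e y) (trans (cong (_+ _) (trans |y|≡ (sym |y′|≡))) (sym (length-block e y′))))
      (λ {y} {y′} |y|≡ |y′|≡ → block-injective e y y′ (trans |y|≡ (sym |y′|≡)) (subst (_< 2 ^ e) (sym |y|≡) 2c<2^e))
      (chunks-length (2 * c) q z |z|≡) (chunks-length (2 * c) q z′ |z′|≡)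
      (trans (length-chunks (2 * c) q z) (sym (length-chunks (2 * c) q z′)))
      (++-cancelˡ (lead a R) _ _ eq))

LargeClass : ℕ → ℕ → Set
LargeClass n k = Σ Word λ v → length v ≡ n × PrefixNormal v × 2 ^ n ≤ 2 ^ k * pnfClassSize n v

ones-take-zeros : ∀ n k → ones (take k (replicate n false)) ≡ 0
ones-take-zeros zero zero = refl
ones-take-zeros zero (suc k) = refl
ones-take-zeros (suc n) zero = refl
ones-take-zeros (suc n) (suc k) = ones-take-zeros n k

zeros-prefixNormal : ∀ n → PrefixNormal (replicate n false)
zeros-prefixNormal n k j _ _ = subst (_≤ _) (sym (window-zeros n j)) z≤n
  where
  window-zeros : ∀ n j → ones (window (replicate n false) j k) ≡ 0
  window-zeros n zero = ones-take-zeros n k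
  window-zeros zero (suc j) = ones-take-zeros 0 k
  window-zeros (suc n) (suc j) = window-zeros n j

zeros-largeClass : ∀ n → LargeClass n n
zeros-largeClass n = zeros , length-replicate n , zeros-prefixNormal n ,
  subst (_≤ 2 ^ n * pnfClassSize n zeros) (*-identityʳ (2 ^ n)) (*-monoʳ-≤ (2 ^ n) nonempty)
  where
  zeros = replicate n false
  nonempty : 1 ≤ pnfClassSize n zeros
  nonempty = injection⇒2^N≤pnfClassSize (λ _ → zeros) 0 n zeros
    (λ _ _ → length-replicate n , isPNF-self zeros (zeros-prefixNormal n)) (λ { {[]} {[]} _ _ _ → refl })

blocks-largeClass : ∀ e c a R q → 2 * c < 2 ^ e → 1 ≤ R → blockLength e c ≤ R → blockLength e c ≤ 2 * a →
  LargeClass (2 * a + R + q * blockLength e c) (2 * a + R + q * (4 * e + 4 * e))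
blocks-largeClass e c a R q 2c<2^e 1≤R ℓ≤R ℓ≤2a = target R h , trans (length-target R h) (length-target-family a R q c e) ,
  target-prefixNormal R h 1≤R ,
  subst (_≤ 2 ^ K * pnfClassSize n (target R h)) (sym (trans (cong (2 ^_) (split a R q c e)) (^-distribˡ-+-* 2 K _)))
    (*-monoʳ-≤ (2 ^ K) (blockFamily e c a R q 2c<2^e 1≤R ℓ≤R ℓ≤2a))
  where
  h = a + q * (c + 4 * e)
  n = 2 * a + R + q * blockLength e c
  K = 2 * a + R + q * (4 * e + 4 * e)
  split : ∀ a R q c e → 2 * a + R + q * (2 * c + (4 * e + 4 * e)) ≡ 2 * a + R + q * (4 * e + 4 * e) + q * (2 * c)
  split = solve-∀

-- Choice of parameters

2x[x+d]≤x²+[x+d]² : ∀ x d → 2 * (x * (x + d)) ≤ x * x + (x + d) * (x + d)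
2x[x+d]≤x²+[x+d]² x d = subst₂ _≤_ (sym (lhs x d)) (sym (rhs x d)) (m≤m+n _ (d * d))
  where
  lhs : ∀ x d → 2 * (x * (x + d)) ≡ 2 * (x * x) + 2 * (x * d)
  lhs = solve-∀
  rhs : ∀ x d → x * x + (x + d) * (x + d) ≡ 2 * (x * x) + 2 * (x * d) + d * d
  rhs = solve-∀

2xy≤x²+y² : ∀ x y → 2 * (x * y) ≤ x * x + y * y
2xy≤x²+y² x y with ≤-total x y
... | inj₁ x≤y = subst (λ y → 2 * (x * y) ≤ x * x + y * y) (m+[n∸m]≡n x≤y) (2x[x+d]≤x²+[x+d]² x (y ∸ x))
... | inj₂ y≤x = subst (λ x → 2 * (x * y) ≤ x * x + y * y) (m+[n∸m]≡n y≤x)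
  (subst₂ _≤_ (cong (2 *_) (*-comm y _)) (+-comm (y * y) _) (2x[x+d]≤x²+[x+d]² y (x ∸ y)))

[x+y+z]²≤3[x²+y²+z²] : ∀ x y z → (x + y + z) * (x + y + z) ≤ 3 * (x * x + y * y + z * z)
[x+y+z]²≤3[x²+y²+z²] x y z = begin
  (x + y + z) * (x + y + z)                                     ≡⟨ expand x y z ⟩
  x * x + y * y + z * z + 2 * (x * y) + 2 * (y * z) + 2 * (x * z)
    ≤⟨ +-mono-≤ (+-mono-≤ (+-monoʳ-≤ (x * x + y * y + z * z) (2xy≤x²+y² x y)) (2xy≤x²+y² y z)) (2xy≤x²+y² x z) ⟩
  x * x + y * y + z * z + (x * x + y * y) + (y * y + z * z) + (x * x + z * z) ≡⟨ collect x y z ⟩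
  3 * (x * x + y * y + z * z)                                   ∎
  where
  open ≤-Reasoning
  expand : ∀ x y z → (x + y + z) * (x + y + z) ≡ x * x + y * y + z * z + 2 * (x * y) + 2 * (y * z) + 2 * (x * z)
  expand = solve-∀
  collect : ∀ x y z → x * x + y * y + z * z + (x * x + y * y) + (y * y + z * z) + (x * x + z * z) ≡ 3 * (x * x + y * y + z * z)
  collect = solve-∀

square-mono : ∀ {a b} → a ≤ b → a * a ≤ b * b
square-mono a≤b = *-mono-≤ a≤b a≤b

-- With M² ≈ n·s and blocks of length ℓ ≈ M + 8e, the overhead 4ℓ + 8eq of the
-- construction is O(M + e + e·n/M) = O(√(n·s)).
exponent-bound : ∀ {n s e M ℓ q K} → 1 ≤ n → 1 ≤ e → s ≤ n → e ≤ 2 * s →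
  n * s ≤ M * M → M * M ≤ 4 * (n * s) → M ≤ ℓ → ℓ ≤ M + 8 * e → q * ℓ ≤ n →
  K ≤ 4 * ℓ + 3 + 8 * e * q → K * K ≤ 16000 * n * s
exponent-bound {n} {s} {e} {M} {ℓ} {q} {K} 1≤n 1≤e s≤n e≤2s X≤M² M²≤4X M≤ℓ ℓ≤ qℓ≤n K≤ = begin
  K * K                                           ≤⟨ square-mono (≤-trans K≤ K≤A+B+D) ⟩
  (A + B + D) * (A + B + D)                       ≤⟨ [x+y+z]²≤3[x²+y²+z²] A B D ⟩
  3 * (A * A + B * B + D * D)                     ≤⟨ *-monoʳ-≤ 3 (+-mono-≤ (+-mono-≤ A²≤ B²≤) D²≤) ⟩
  3 * (64 * (n * s) + 4900 * (n * s) + 256 * (n * s)) ≡⟨ total n s ⟩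
  15660 * n * s                                   ≤⟨ *-monoˡ-≤ s (*-monoˡ-≤ n (m≤m+n 15660 340)) ⟩
  16000 * n * s                                   ∎
  where
  open ≤-Reasoning
  A = 4 * M
  B = 35 * e
  D = 8 * e * q
  total : ∀ n s → 3 * (64 * (n * s) + 4900 * (n * s) + 256 * (n * s)) ≡ 15660 * n * s
  total = solve-∀
  K≤A+B+D : 4 * ℓ + 3 + 8 * e * q ≤ A + B + D
  K≤A+B+D = +-monoˡ-≤ D (begin
    4 * ℓ + 3             ≤⟨ +-mono-≤ (*-monoʳ-≤ 4 ℓ≤) (*-monoʳ-≤ 3 1≤e) ⟩
    4 * (M + 8 * e) + 3 * e ≡⟨ regroup M e ⟩
    A + B                 ∎)
    where
    regroup : ∀ M e → 4 * (M + 8 * e) + 3 * e ≡ 4 * M + 35 * e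
    regroup = solve-∀
  A²≤ : A * A ≤ 64 * (n * s)
  A²≤ = begin
    4 * M * (4 * M)       ≡⟨ sixteen M ⟩
    16 * (M * M)          ≤⟨ *-monoʳ-≤ 16 M²≤4X ⟩
    16 * (4 * (n * s))    ≡⟨ *-assoc 16 4 (n * s) ⟨
    64 * (n * s)          ∎
    where
    sixteen : ∀ M → 4 * M * (4 * M) ≡ 16 * (M * M)
    sixteen = solve-∀
  B²≤ : B * B ≤ 4900 * (n * s)
  B²≤ = begin
    35 * e * (35 * e)     ≡⟨ square 35 e ⟩
    1225 * (e * e)        ≤⟨ *-monoʳ-≤ 1225 (square-mono e≤2s) ⟩
    1225 * (2 * s * (2 * s)) ≡⟨ square-2s s ⟩
    4900 * (s * s)        ≤⟨ *-monoʳ-≤ 4900 (*-monoˡ-≤ s s≤n) ⟩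
    4900 * (n * s)        ∎
    where
    square : ∀ k e → k * e * (k * e) ≡ k * k * (e * e)
    square = solve-∀
    square-2s : ∀ s → 1225 * (2 * s * (2 * s)) ≡ 4900 * (s * s)
    square-2s = solve-∀
  sq²≤n : s * (q * q) ≤ n
  sq²≤n = *-cancelˡ-≤ n {{>-nonZero 1≤n}} (begin
    n * (s * (q * q))     ≡⟨ shuffle n s q ⟩
    q * q * (n * s)       ≤⟨ *-monoʳ-≤ (q * q) X≤M² ⟩
    q * q * (M * M)       ≡⟨ shuffle′ q M ⟩
    q * M * (q * M)       ≤⟨ square-mono (≤-trans (*-monoʳ-≤ q M≤ℓ) qℓ≤n) ⟩
    n * n                 ∎)
    where
    shuffle : ∀ n s q → n * (s * (q * q)) ≡ q * q * (n * s)
    shuffle = solve-∀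
    shuffle′ : ∀ q M → q * q * (M * M) ≡ q * M * (q * M)
    shuffle′ = solve-∀
  D²≤ : D * D ≤ 256 * (n * s)
  D²≤ = begin
    8 * e * q * (8 * e * q)      ≡⟨ expand e q ⟩
    64 * (e * e) * (q * q)       ≤⟨ *-monoˡ-≤ (q * q) (*-monoʳ-≤ 64 (square-mono e≤2s)) ⟩
    64 * (2 * s * (2 * s)) * (q * q) ≡⟨ regroup s q ⟩
    256 * s * (s * (q * q))      ≤⟨ *-monoʳ-≤ (256 * s) sq²≤n ⟩
    256 * s * n                  ≡⟨ final s n ⟩
    256 * (n * s)                ∎
    where
    expand : ∀ e q → 8 * e * q * (8 * e * q) ≡ 64 * (e * e) * (q * q)
    expand = solve-∀
    regroup : ∀ s q → 64 * (2 * s * (2 * s)) * (q * q) ≡ 256 * s * (s * (q * q))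
    regroup = solve-∀
    final : ∀ s n → 256 * s * n ≡ 256 * (n * s)
    final = solve-∀

⌈log₂⌉-unfold : ∀ n → ⌈log₂ suc (suc n) ⌉ ≡ suc ⌈log₂ ⌈ suc (suc n) /2⌉ ⌉
⌈log₂⌉-unfold n = cong suc (⌈log2⌉-acc-irrelevant ⌈ suc (suc n) /2⌉)

n≤2^⌈log₂n⌉ : ∀ n → n ≤ 2 ^ ⌈log₂ n ⌉
n≤2^⌈log₂n⌉ = <-rec _ go
  where
  go : ∀ n → (∀ {m} → m < n → m ≤ 2 ^ ⌈log₂ m ⌉) → n ≤ 2 ^ ⌈log₂ n ⌉
  go zero _ = z≤n
  go (suc zero) _ = s≤s z≤n
  go (suc (suc n)) rec = subst (λ l → suc (suc n) ≤ 2 ^ l) (sym (⌈log₂⌉-unfold n)) (begin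
    suc (suc n)                         ≡⟨ ⌊n/2⌋+⌈n/2⌉≡n (suc (suc n)) ⟨
    ⌊ suc (suc n) /2⌋ + ⌈ suc (suc n) /2⌉ ≤⟨ +-monoˡ-≤ _ (⌊n/2⌋≤⌈n/2⌉ (suc (suc n))) ⟩
    ⌈ suc (suc n) /2⌉ + ⌈ suc (suc n) /2⌉ ≡⟨ cong (⌈ suc (suc n) /2⌉ +_) (+-identityʳ _) ⟨
    2 * ⌈ suc (suc n) /2⌉               ≤⟨ *-monoʳ-≤ 2 (rec (⌈n/2⌉<n n)) ⟩
    2 * 2 ^ ⌈log₂ ⌈ suc (suc n) /2⌉ ⌉  ∎)
    where open ≤-Reasoning

⌈log₂n⌉≤n : ∀ n → ⌈log₂ n ⌉ ≤ n
⌈log₂n⌉≤n = <-rec _ go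
  where
  go : ∀ n → (∀ {m} → m < n → ⌈log₂ m ⌉ ≤ m) → ⌈log₂ n ⌉ ≤ n
  go zero _ = z≤n
  go (suc zero) _ = z≤n
  go (suc (suc n)) rec = subst (_≤ suc (suc n)) (sym (⌈log₂⌉-unfold n)) (≤-trans (s≤s (rec (⌈n/2⌉<n n))) (⌈n/2⌉<n n))

2^n*2^n≡4^n : ∀ n → 2 ^ n * 2 ^ n ≡ 4 ^ n
2^n*2^n≡4^n zero = refl
2^n*2^n≡4^n (suc n) = trans (regroup (2 ^ n)) (cong (4 *_) (2^n*2^n≡4^n n))
  where
  regroup : ∀ x → 2 * x * (2 * x) ≡ 4 * (x * x)
  regroup = solve-∀

scale : ∀ X → 1 ≤ X → ∃ λ e → 1 ≤ e × X ≤ 4 ^ e × 4 ^ e ≤ 4 * X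
scale (suc zero) _ = 1 , ≤-refl , s≤s z≤n , ≤-refl
scale (suc (suc X)) _ with scale (suc X) (s≤s z≤n)
... | e , 1≤e , X≤ , ≤4X with suc (suc X) ≤? 4 ^ e
...   | yes fits = e , 1≤e , fits , ≤-trans ≤4X (*-monoʳ-≤ 4 (n≤1+n (suc X)))
...   | no overflows = suc e , s≤s z≤n ,
          ≤-trans (s≤s X≤) (1+y≤4y (m^n>0 4 e)) , *-monoʳ-≤ 4 (<⇒≤ (≰⇒> overflows))
  where
  1+y≤4y : ∀ {y} → 1 ≤ y → suc y ≤ 4 * y
  1+y≤4y {y} 1≤y = ≤-trans (+-monoˡ-≤ y 1≤y) (+-monoʳ-≤ y (m≤m+n y _))

-- R absorbs the parity of the remainder, since the target word has length R + 2h.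
decompose : ∀ n ℓ → 1 ≤ ℓ → 3 * ℓ + 3 ≤ n →
  ∃ λ a → ∃ λ R → ∃ λ q → n ≡ 2 * a + R + q * ℓ × ℓ < R × ℓ ≤ 2 * a × 2 * a + R ≤ 4 * ℓ + 3
decompose n ℓ 1≤ℓ 3ℓ+3≤n = a , R , q , n≡ , s≤s (m≤m+n ℓ (r % 2)) , ≤-trans (m≤m+n ℓ _) (m≤m+n (ℓ + suc (r / 2)) _) , prefix≤
  where
  instance _ = >-nonZero 1≤ℓ
  n′ = n ∸ (3 * ℓ + 3)
  q = n′ / ℓ
  r = n′ % ℓ
  a = ℓ + suc (r / 2)
  R = suc (ℓ + r % 2)
  prefix≡ : 2 * a + R ≡ 3 * ℓ + 3 + r
  prefix≡ = trans (arrange ℓ (r / 2) (r % 2)) (cong (3 * ℓ + 3 +_) (sym (m≡m%n+[m/n]*n r 2)))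
    where
    arrange : ∀ ℓ h b → 2 * (ℓ + suc h) + suc (ℓ + b) ≡ 3 * ℓ + 3 + (b + h * 2)
    arrange = solve-∀
  n≡ : n ≡ 2 * a + R + q * ℓ
  n≡ = begin
    n                         ≡⟨ m∸n+n≡m 3ℓ+3≤n ⟨
    n′ + (3 * ℓ + 3)          ≡⟨ cong (_+ (3 * ℓ + 3)) (m≡m%n+[m/n]*n n′ ℓ) ⟩
    r + q * ℓ + (3 * ℓ + 3)   ≡⟨ arrange r (q * ℓ) (3 * ℓ + 3) ⟩
    3 * ℓ + 3 + r + q * ℓ     ≡⟨ cong (_+ q * ℓ) prefix≡ ⟨
    2 * a + R + q * ℓ         ∎
    where
    open ≡-Reasoning
    arrange : ∀ r x y → r + x + y ≡ y + r + x
    arrange = solve-∀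
  prefix≤ : 2 * a + R ≤ 4 * ℓ + 3
  prefix≤ = begin
    2 * a + R                 ≡⟨ prefix≡ ⟩
    3 * ℓ + 3 + r             ≤⟨ +-monoʳ-≤ (3 * ℓ + 3) (<⇒≤ (m%n<n n′ ℓ)) ⟩
    3 * ℓ + 3 + ℓ             ≡⟨ arrange ℓ ⟩
    4 * ℓ + 3                 ∎
    where
    open ≤-Reasoning
    arrange : ∀ ℓ → 3 * ℓ + 3 + ℓ ≡ 4 * ℓ + 3
    arrange = solve-∀

exponent≤2log : ∀ n e → 2 ≤ n → 4 ^ e ≤ 4 * (n * ⌈log₂ n ⌉) → e ≤ 2 * ⌈log₂ n ⌉
exponent≤2log n e 2≤n 4^e≤ = ≤-trans e≤1+s (≤-trans (+-monoˡ-≤ s 1≤s) (≤-reflexive (cong (s +_) (sym (+-identityʳ s)))))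
  where
  s = ⌈log₂ n ⌉
  1≤s : 1 ≤ s
  1≤s = ⌈log₂⌉-mono-≤ 2≤n
  4^e≤4^[1+s] : 4 ^ e ≤ 4 ^ suc s
  4^e≤4^[1+s] = begin
    4 ^ e                 ≤⟨ 4^e≤ ⟩
    4 * (n * s)           ≤⟨ *-monoʳ-≤ 4 (*-mono-≤ (n≤2^⌈log₂n⌉ n) (≤-trans (⌈log₂n⌉≤n n) (n≤2^⌈log₂n⌉ n))) ⟩
    4 * (2 ^ s * 2 ^ s)   ≡⟨ cong (4 *_) (2^n*2^n≡4^n s) ⟩
    4 ^ suc s             ∎
    where open ≤-Reasoning
  e≤1+s : e ≤ suc s
  e≤1+s with e ≤? suc s
  ... | yes e≤ = e≤
  ... | no e≰ = contradiction 4^e≤4^[1+s] (<⇒≱ (^-monoʳ-< 4 (s≤s (s≤s z≤n)) (≰⇒> e≰)))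

-- Blocks of 2c free letters with c = 2^e′ − 1, so that indices up to 2c fit in e = e′ + 1 bits.
module _ (e′ : ℕ) where

  private
    e = suc e′
    c = 2 ^ e′ ∸ 1

  2c+2≡2^e : 2 * c + 2 ≡ 2 ^ e
  2c+2≡2^e = trans (sym (*-distribˡ-+ 2 c 1)) (cong (2 *_) (m∸n+n≡m (m^n>0 2 e′)))

  2c<2^e : 2 * c < 2 ^ e
  2c<2^e = subst (2 * c <_) 2c+2≡2^e (m<m+n (2 * c) (s≤s z≤n))

  2^e≤blockLength : 2 ^ e ≤ blockLength e c
  2^e≤blockLength = subst (_≤ blockLength e c) 2c+2≡2^e (+-monoʳ-≤ (2 * c) (≤-trans (≤-trans (s≤s (s≤s z≤n)) (*-monoʳ-≤ 4 (s≤s z≤n))) (m≤m+n (4 * e) (4 * e))))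

  blockLength≤ : blockLength e c ≤ 2 ^ e + 8 * e
  blockLength≤ = subst (blockLength e c ≤_) (cong (_+ 8 * e) 2c+2≡2^e) (≤-trans (+-monoʳ-≤ (2 * c) (≤-reflexive (eight e)))
                                                                           (+-monoˡ-≤ (8 * e) (m≤m+n (2 * c) 2)))
    where
    eight : ∀ e → 4 * e + 4 * e ≡ 8 * e
    eight = solve-∀

largeClass-exists : ∀ n → 4 ≤ n → ∃ λ k → k * k ≤ 16000 * n * ⌈log₂ n ⌉ × LargeClass n k
largeClass-exists n 4≤n with scale (n * ⌈log₂ n ⌉) (*-mono-≤ (≤-trans (s≤s z≤n) 4≤n) (⌈log₂⌉-mono-≤ (≤-trans (s≤s (s≤s z≤n)) 4≤n)))
... | zero , () , _
... | suc e′ , 1≤e , X≤4^e , 4^e≤4X = witness (3 * ℓ + 3 ≤? n)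
  where
  s = ⌈log₂ n ⌉
  e = suc e′
  c = 2 ^ e′ ∸ 1
  ℓ = blockLength e c
  bound : ∀ q K → q * ℓ ≤ n → K ≤ 4 * ℓ + 3 + 8 * e * q → K * K ≤ 16000 * n * s
  bound q K = exponent-bound (≤-trans (s≤s z≤n) 4≤n) 1≤e (⌈log₂n⌉≤n n)
    (exponent≤2log n e (≤-trans (s≤s (s≤s z≤n)) 4≤n) 4^e≤4X)
    (subst (n * s ≤_) (sym (2^n*2^n≡4^n e)) X≤4^e) (subst (_≤ 4 * (n * s)) (sym (2^n*2^n≡4^n e)) 4^e≤4X)
    (2^e≤blockLength e′) (blockLength≤ e′)
  witness : Dec (3 * ℓ + 3 ≤ n) → ∃ λ k → k * k ≤ 16000 * n * s × LargeClass n k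
  witness (no short) = n , bound 0 n z≤n (≤-trans (<⇒≤ (≰⇒> short)) (≤-trans (+-monoˡ-≤ 3 (*-monoˡ-≤ ℓ (n≤1+n 3))) (m≤m+n _ _))) , zeros-largeClass n
  witness (yes long) =
    let a , R , q , n≡ , ℓ<R , ℓ≤2a , prefix≤ = decompose n ℓ (≤-trans (m^n>0 2 e) (2^e≤blockLength e′)) long
        K = 2 * a + R + q * (4 * e + 4 * e)
    in K , bound q K (subst (q * ℓ ≤_) (sym n≡) (m≤n+m (q * ℓ) (2 * a + R)))
                     (subst (K ≤_) (eight (4 * ℓ + 3) q e) (+-monoˡ-≤ _ prefix≤)) ,
       subst (λ m → LargeClass m K) (sym n≡) (blocks-largeClass e c a R q (2c<2^e e′) (≤-trans (s≤s z≤n) ℓ<R) (<⇒≤ ℓ<R) ℓ≤2a)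
    where
    eight : ∀ l q e → l + q * (4 * e + 4 * e) ≡ l + 8 * e * q
    eight = solve-∀

theorem2 : Σ ℕ λ C → Σ ℕ λ N → ∀ n → N ≤ n →
    Σ Word λ v → length v ≡ n × PrefixNormal v ×
      (Σ ℕ λ k → k * k ≤ C * n * ⌈log₂ n ⌉ × 2 ^ n ≤ 2 ^ k * pnfClassSize n v)
theorem2 = 16000 , 4 , λ n 4≤n →
  let k , k²≤ , v , |v|≡n , normal , count = largeClass-exists n 4≤n
  in v , |v|≡n , normal , k , k²≤ , count
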